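{- For any integer $t\geq 2$, there exists a connected graph $G$ such that $fix(G)=t=F_{xt}(G)$.
   Context: All graphs are finite and simple. A fixing set of $G$ is a set $F\subseteq V(G)$ such that the only automorphism fixing every vertex of $F$ is the identity; $fix(G)$ is the minimum size of a fixing set. A fixatic partition is a partition of $V(G)$ into classes each of which is a fixing set; $F_{xt}(G)$ is the maximum number of classes in a fixatic partition. -}

module Defs where

open import Data.Nat using (ℕ; _≤_)
open import Data.Bool using (Bool; false; true)
open import Data.Fin using (Fin)
open import Data.Fin.Subset using (Subset; _∈_; ∣_∣)
open import Data.Fin.Permutation using (Permutation′; _⟨$⟩ʳ_)
open import Data.Product using (Σ; ∃; _×_)
open import Relation.Binary.PropositionalEquality using (_≡_)

record Graph : Set where
  field
    n     : ℕ
    adj   : Fin n → Fin n → Bool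
    sym   : ∀ u v → adj u v ≡ adj v u
    loopless : ∀ v → adj v v ≡ false

module _ (G : Graph) where
  open Graph G

  IsAutomorphism : Permutation′ n → Set
  IsAutomorphism σ = ∀ u v → adj (σ ⟨$⟩ʳ u) (σ ⟨$⟩ʳ v) ≡ adj u v

  data Reach : Fin n → Fin n → Set where
    here : ∀ {v} → Reach v v
    step : ∀ {u w v} → adj u w ≡ true → Reach w v → Reach u v

  Connected : Set
  Connected = ∀ u v → Reach u v

  FixingPred : (Fin n → Set) → Set
  FixingPred P = ∀ (σ : Permutation′ n) → IsAutomorphism σ →
                 (∀ v → P v → σ ⟨$⟩ʳ v ≡ v) → ∀ v → σ ⟨$⟩ʳ v ≡ v

  IsFixingSet : Subset n → Set
  IsFixingSet F = FixingPred (λ v → v ∈ F)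

  FixNumberIs : ℕ → Set
  FixNumberIs t = (Σ (Subset n) λ F → IsFixingSet F × ∣ F ∣ ≡ t)
                × (∀ F → IsFixingSet F → t ≤ ∣ F ∣)

  -- a fixatic partition into k classes: class map c : V → Fin k, every
  -- class nonempty (c surjective), and every class is a fixing set
  IsFixaticPartition : (k : ℕ) → (Fin n → Fin k) → Set
  IsFixaticPartition k c = (∀ i → ∃ λ v → c v ≡ i)
                         × (∀ i → FixingPred (λ v → c v ≡ i))

  FixaticNumberIs : ℕ → Set
  FixaticNumberIs t = (Σ (Fin n → Fin t) λ c → IsFixaticPartition t c)
                    × (∀ k (c : Fin n → Fin k) → IsFixaticPartition k c → k ≤ t)

-- Write t = L + 1 with L ≥ 1.  The graph G_t has a hub adjacent to all
-- vertices, t "x-cliques" and two "y-cliques" of size L, markers mark p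
-- joining the p-th vertices of all cliques, and an apex adjacent to every
-- x-vertex (it tells x-cliques from y-cliques).  Its automorphisms are the
-- relabellings of the x-cliques and of the y-cliques, which is used in both
-- directions:
--
--   * Lower bound (Hitting): a fixing set must meet some y-clique and all
--     x-cliques but one, otherwise a transposition of cliques fixes it.
--     This gives fix(G) ≥ t, and, counting the t · L x-vertices, at most t
--     classes in a fixatic partition.
--   * Upper bound (Rigidity): a set containing a y-vertex and, at each
--     position q, a vertex x (β q) q with β hitting all x-cliques but one,
--     is fixing: adjacency to these seeds identifies every vertex.
--   * A cyclic Latin square (CyclicShift) splits the x-vertices into t
--     classes each containing such a seed configuration.

module Submission where

open import Defs
open import Data.Nat using (ℕ; _≥_)
open import Data.Product using (Σ; _×_)

open import Data.Nat using (zero; suc; _+_; _*_; _∸_; _≤_; z≤n; s≤s; _%_)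
open import Data.Nat.Properties
  using (≤-trans; ≤-reflexive; ≤-antisym; <⇒≤; +-identityʳ; +-suc; n≤1+n; +-monoʳ-≤; +-comm; +-assoc;
         *-cancelʳ-≤; m+[n∸m]≡n)
open import Data.Nat.DivMod using (_mod_; %-distribˡ-+; m%n%n≡m%n; [m+n]%n≡m%n; m<n⇒m%n≡m)
open import Data.Bool using (Bool; true; false; _∧_; not)
open import Data.Bool.Properties using (∧-zeroʳ; ∧-identityʳ)
open import Data.Unit using (⊤; tt)
open import Data.Empty using (⊥; ⊥-elim)
open import Data.Sum using (_⊎_; inj₁; inj₂)
open import Data.Sum.Function.Propositional using (_⊎-↔_)
open import Data.Product using (∃; _,_; proj₁; proj₂; uncurry)
open import Data.Vec using (_∷_; [])
open import Data.Fin as Fin using (Fin; toℕ; punchIn)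
open import Data.Fin.Patterns using (0F; 1F)
open import Data.Fin.Properties
  using (_≟_; 0≢1+n; suc-injective; toℕ-fromℕ<; toℕ-injective; toℕ<n; punchIn-injective; punchInᵢ≢i;
         injective⇒≤; 1↔⊤; +↔⊎; *↔×; any?)
open import Data.Fin.Subset using (Subset; _∈_; ∣_∣; ⁅_⁆; _∪_; _-_; inside; outside) renaming (⊥ to ∅)
open import Data.Fin.Subset.Properties
  using (_∈?_; ∣⊥∣≡0; ∣⁅x⁆∣≡1; x∈⁅x⁆; x∈p∪q⁺; x∈p∧x≢y⇒x∈p-y; x∈p⇒∣p-x∣<∣p∣)
import Data.Fin.Permutation as Perm
open import Data.Fin.Permutation
  using (Permutation′; transpose; _⟨$⟩ʳ_; _⟨$⟩ˡ_; inverseˡ; inverseʳ; permutation)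
open import Function using (_∘_; _∋_; Injective)
open import Function.Bundles using (_↔_; Inverse; Injection; mk↔ₛ′)
open import Function.Properties.Inverse using (↔-trans; ↔-refl; ↔-sym; ↔⇒↣)
open import Relation.Nullary using (Dec; yes; no; ¬_; does; ¬?)
open import Relation.Nullary.Decidable using (dec-true; dec-false; decidable-stable)
open import Relation.Unary using (Decidable)
open import Relation.Binary.PropositionalEquality

false≢true : false ≢ true
false≢true ()

_==_ : ∀ {k} → Fin k → Fin k → Bool
i == j = does (i ≟ j)

==-refl : ∀ {k} (i : Fin k) → (i == i) ≡ true
==-refl i = dec-true (i ≟ i) refl

==-false : ∀ {k} {i j : Fin k} → i ≢ j → (i == j) ≡ false
==-false {i = i} {j} = dec-false (i ≟ j)

==-sound : ∀ {k} {i j : Fin k} → (i == j) ≡ true → i ≡ j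
==-sound {i = i} {j} eq with i ≟ j
... | yes i≡j = i≡j

==-sym : ∀ {k} (i j : Fin k) → (i == j) ≡ (j == i)
==-sym i j with i ≟ j
... | yes refl = sym (==-refl i)
... | no i≢j = sym (==-false (i≢j ∘ sym))

==-injective : ∀ {k} {π : Fin k → Fin k} → Injective _≡_ _≡_ π → ∀ b c → (π b == π c) ≡ (b == c)
==-injective {π = π} inj b c with b ≟ c
... | yes refl = ==-refl (π b)
... | no b≢c = ==-false (b≢c ∘ inj)

==-transfer : ∀ {k} {c c′ d : Fin k} → (c′ == d) ≡ (c == d) → d ≡ c → c′ ≡ c
==-transfer {c = c} same refl = ==-sound (trans same (==-refl c))

fin2-other : ∀ {a a′ c : Fin 2} → a ≢ c → a′ ≢ c → a′ ≡ a
fin2-other {0F} {0F} _ _ = refl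
fin2-other {1F} {1F} _ _ = refl
fin2-other {0F} {1F} {0F} a≢c _ = ⊥-elim (a≢c refl)
fin2-other {0F} {1F} {1F} _ a′≢c = ⊥-elim (a′≢c refl)
fin2-other {1F} {0F} {0F} _ a′≢c = ⊥-elim (a′≢c refl)
fin2-other {1F} {0F} {1F} a≢c _ = ⊥-elim (a≢c refl)

fin2-by-test : ∀ {a a′ c : Fin 2} → (a′ == c) ≡ (a == c) → a′ ≡ a
fin2-by-test {a} {a′} {c} same with a ≟ c
... | yes refl = ==-sound same
... | no a≢c = fin2-other a≢c (λ a′≡c → false≢true (trans (sym same) (dec-true (a′ ≟ c) a′≡c)))

transpose-source : ∀ {k} (i j : Fin k) → transpose i j ⟨$⟩ʳ i ≡ j
transpose-source i j rewrite dec-true (i ≟ i) refl = refl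

transpose-other : ∀ {k} {i j l : Fin k} → l ≢ i → l ≢ j → transpose i j ⟨$⟩ʳ l ≡ l
transpose-other {i = i} {j} {l} l≢i l≢j rewrite dec-false (l ≟ i) l≢i | dec-false (l ≟ j) l≢j = refl

permutation-injective : ∀ {k} (π : Permutation′ k) → Injective _≡_ _≡_ (π ⟨$⟩ʳ_)
permutation-injective π = Injection.injective (↔⇒↣ π)

product-injection⇒≤ : ∀ {a b c d} (h : Fin a × Fin b → Fin c × Fin d) → Injective _≡_ _≡_ h → a * b ≤ c * d
product-injection⇒≤ {a} {b} {c} {d} h h-inj =
  injective⇒≤ {f = Inverse.from (*↔× {c} {d}) ∘ h ∘ Inverse.to (*↔× {a} {b})}
    (Injection.injective (↔⇒↣ *↔×) ∘ h-inj ∘ Injection.injective (↔⇒↣ (↔-sym *↔×)))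

∣p∪q∣≤∣p∣+∣q∣ : ∀ {n} (p q : Subset n) → ∣ p ∪ q ∣ ≤ ∣ p ∣ + ∣ q ∣
∣p∪q∣≤∣p∣+∣q∣ [] [] = z≤n
∣p∪q∣≤∣p∣+∣q∣ (outside ∷ p) (outside ∷ q) = ∣p∪q∣≤∣p∣+∣q∣ p q
∣p∪q∣≤∣p∣+∣q∣ (outside ∷ p) (inside ∷ q) =
  ≤-trans (s≤s (∣p∪q∣≤∣p∣+∣q∣ p q)) (≤-reflexive (sym (+-suc ∣ p ∣ ∣ q ∣)))
∣p∪q∣≤∣p∣+∣q∣ (inside ∷ p) (outside ∷ q) = s≤s (∣p∪q∣≤∣p∣+∣q∣ p q)
∣p∪q∣≤∣p∣+∣q∣ (inside ∷ p) (inside ∷ q) =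
  s≤s (≤-trans (∣p∪q∣≤∣p∣+∣q∣ p q) (+-monoʳ-≤ ∣ p ∣ (n≤1+n ∣ q ∣)))

image : ∀ {m n} → (Fin m → Fin n) → Subset n
image {zero} g = ∅
image {suc m} g = ⁅ g 0F ⁆ ∪ image (g ∘ Fin.suc)

∈-image : ∀ {m n} (g : Fin m → Fin n) j → g j ∈ image g
∈-image g 0F = x∈p∪q⁺ (inj₁ (x∈⁅x⁆ (g 0F)))
∈-image g (Fin.suc j) = x∈p∪q⁺ (inj₂ (∈-image (g ∘ Fin.suc) j))

∣image∣≤ : ∀ {m n} (g : Fin m → Fin n) → ∣ image g ∣ ≤ m
∣image∣≤ {zero} {n} g = ≤-reflexive (∣⊥∣≡0 n)
∣image∣≤ {suc m} g = begin
  ∣ ⁅ g 0F ⁆ ∪ image (g ∘ Fin.suc) ∣      ≤⟨ ∣p∪q∣≤∣p∣+∣q∣ ⁅ g 0F ⁆ _ ⟩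
  ∣ ⁅ g 0F ⁆ ∣ + ∣ image (g ∘ Fin.suc) ∣   ≡⟨ cong (_+ ∣ image (g ∘ Fin.suc) ∣) (∣⁅x⁆∣≡1 (g 0F)) ⟩
  suc ∣ image (g ∘ Fin.suc) ∣              ≤⟨ s≤s (∣image∣≤ (g ∘ Fin.suc)) ⟩
  suc m                                    ∎
  where open Data.Nat.Properties.≤-Reasoning

injection⇒≤∣F∣ : ∀ {m n} (g : Fin m → Fin n) → Injective _≡_ _≡_ g →
                 ∀ (F : Subset n) → (∀ j → g j ∈ F) → m ≤ ∣ F ∣
injection⇒≤∣F∣ {zero} g inj F g∈F = z≤n
injection⇒≤∣F∣ {suc m} g inj F g∈F =
  ≤-trans (s≤s (injection⇒≤∣F∣ (g ∘ Fin.suc) (λ e → suc-injective (inj e)) (F - g 0F) rest))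
          (x∈p⇒∣p-x∣<∣p∣ (g∈F 0F))
  where
  rest : ∀ j → g (Fin.suc j) ∈ F - g 0F
  rest j = x∈p∧x≢y⇒x∈p-y (g∈F (Fin.suc j)) (λ e → 0≢1+n (sym (inj e)))

module _ (G : Graph) (w : Fin (Graph.n G)) (w~ : ∀ v → v ≢ w → Graph.adj G w v ≡ true) where

  walk-from-universal : ∀ v → Reach G w v
  walk-from-universal v with v ≟ w
  ... | yes refl = here
  ... | no v≢w = step (w~ v v≢w) here

  universal⇒connected : Connected G
  universal⇒connected u v with u ≟ w
  ... | yes refl = walk-from-universal v
  ... | no u≢w = step (trans (Graph.sym G u w) (w~ u u≢w)) (walk-from-universal v)

-- Cyclic shifts on Fin t, t = L + 1.  They provide the Latin square used to
-- split the cliques of the construction evenly among t classes: class i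
-- takes, at position q < L, a vertex of clique  seed i q = i + q + 1 (mod t).
module CyclicShift (L : ℕ) where

  private
    t : ℕ
    t = suc L

  shift : Fin t → ℕ → Fin t
  shift i k = (toℕ i + k) mod t

  toℕ-shift : ∀ i k → toℕ (shift i k) ≡ (toℕ i + k) % t
  toℕ-shift i k = toℕ-fromℕ< _

  %-absorbˡ : ∀ a c → (a % t + c) % t ≡ (a + c) % t
  %-absorbˡ a c = begin
    (a % t + c) % t           ≡⟨ %-distribˡ-+ (a % t) c t ⟩
    (a % t % t + c % t) % t   ≡⟨ cong (λ z → (z + c % t) % t) (m%n%n≡m%n a t) ⟩
    (a % t + c % t) % t       ≡⟨ %-distribˡ-+ a c t ⟨
    (a + c) % t               ∎
    where open ≡-Reasoning

  shift-zero : ∀ i → shift i 0 ≡ i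
  shift-zero i = toℕ-injective (begin
    toℕ (shift i 0)   ≡⟨ toℕ-shift i 0 ⟩
    (toℕ i + 0) % t   ≡⟨ cong (_% t) (+-identityʳ (toℕ i)) ⟩
    toℕ i % t         ≡⟨ m<n⇒m%n≡m (toℕ<n i) ⟩
    toℕ i             ∎)
    where open ≡-Reasoning

  shift-period : ∀ i → shift i t ≡ i
  shift-period i = toℕ-injective (begin
    toℕ (shift i t)   ≡⟨ toℕ-shift i t ⟩
    (toℕ i + t) % t   ≡⟨ [m+n]%n≡m%n (toℕ i) t ⟩
    toℕ i % t         ≡⟨ m<n⇒m%n≡m (toℕ<n i) ⟩
    toℕ i             ∎)
    where open ≡-Reasoning

  shift-shift : ∀ i k l → shift (shift i k) l ≡ shift i (k + l)
  shift-shift i k l = toℕ-injective (begin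
    toℕ (shift (shift i k) l)    ≡⟨ toℕ-shift (shift i k) l ⟩
    (toℕ (shift i k) + l) % t    ≡⟨ cong (λ z → (z + l) % t) (toℕ-shift i k) ⟩
    ((toℕ i + k) % t + l) % t    ≡⟨ %-absorbˡ (toℕ i + k) l ⟩
    (toℕ i + k + l) % t          ≡⟨ cong (_% t) (+-assoc (toℕ i) k l) ⟩
    (toℕ i + (k + l)) % t        ≡⟨ toℕ-shift i (k + l) ⟨
    toℕ (shift i (k + l))        ∎)
    where open ≡-Reasoning

  shift-exchange : ∀ i j k → shift i (toℕ (shift j k)) ≡ shift j (toℕ i + k)
  shift-exchange i j k = toℕ-injective (begin
    toℕ (shift i (toℕ (shift j k)))     ≡⟨ toℕ-shift i _ ⟩
    (toℕ i + toℕ (shift j k)) % t       ≡⟨ cong (λ z → (toℕ i + z) % t) (toℕ-shift j k) ⟩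
    (toℕ i + (toℕ j + k) % t) % t       ≡⟨ cong (_% t) (+-comm (toℕ i) _) ⟩
    ((toℕ j + k) % t + toℕ i) % t       ≡⟨ %-absorbˡ (toℕ j + k) (toℕ i) ⟩
    (toℕ j + k + toℕ i) % t             ≡⟨ cong (_% t) (+-assoc (toℕ j) k (toℕ i)) ⟩
    (toℕ j + (k + toℕ i)) % t           ≡⟨ cong (λ z → (toℕ j + z) % t) (+-comm k (toℕ i)) ⟩
    (toℕ j + (toℕ i + k)) % t           ≡⟨ toℕ-shift j _ ⟨
    toℕ (shift j (toℕ i + k))           ∎)
    where open ≡-Reasoning

  seed : Fin t → Fin L → Fin t
  seed i q = shift i (suc (toℕ q))

  -- the class of the vertex at position q of clique b
  colour : Fin t → Fin L → Fin t
  colour b q = shift b (L ∸ toℕ q)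

  colour-seed : ∀ i q → colour (seed i q) q ≡ i
  colour-seed i q = begin
    shift (shift i (suc (toℕ q))) (L ∸ toℕ q)   ≡⟨ shift-shift i _ _ ⟩
    shift i (suc (toℕ q + (L ∸ toℕ q)))         ≡⟨ cong (shift i ∘ suc) (m+[n∸m]≡n (<⇒≤ (toℕ<n q))) ⟩
    shift i t                                   ≡⟨ shift-period i ⟩
    i                                           ∎
    where open ≡-Reasoning

  seed-cover : ∀ i b → b ≢ i → ∃ λ q → seed i q ≡ b
  seed-cover i b b≢i = from-offset (shift b (t ∸ toℕ i)) refl
    where
    lands : shift i (toℕ (shift b (t ∸ toℕ i))) ≡ b
    lands = begin
      shift i (toℕ (shift b (t ∸ toℕ i)))   ≡⟨ shift-exchange i b _ ⟩
      shift b (toℕ i + (t ∸ toℕ i))         ≡⟨ cong (shift b) (m+[n∸m]≡n (<⇒≤ (toℕ<n i))) ⟩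
      shift b t                             ≡⟨ shift-period b ⟩
      b                                     ∎
      where open ≡-Reasoning
    from-offset : ∀ δ → δ ≡ shift b (t ∸ toℕ i) → ∃ λ q → seed i q ≡ b
    from-offset 0F eq = ⊥-elim (b≢i (trans (sym lands) (trans (cong (shift i ∘ toℕ) (sym eq)) (shift-zero i))))
    from-offset (Fin.suc q) eq = q , trans (cong (shift i ∘ toℕ) eq) lands

module EnumeratedGraph {V : Set} {n : ℕ} (code : Fin n ↔ V)
                       (adjV : V → V → Bool)
                       (adjV-sym : ∀ u v → adjV u v ≡ adjV v u)
                       (adjV-irrefl : ∀ v → adjV v v ≡ false) where

  open Inverse code public using ()
    renaming (to to decode; from to encode; strictlyInverseˡ to decode-encode; strictlyInverseʳ to encode-decode)

  graph : Graph
  graph = record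
    { n = n
    ; adj = λ i j → adjV (decode i) (decode j)
    ; sym = λ i j → adjV-sym (decode i) (decode j)
    ; loopless = λ i → adjV-irrefl (decode i)
    }

  encode-injective : Injective _≡_ _≡_ encode
  encode-injective = Injection.injective (↔⇒↣ (↔-sym code))

  PreservesAdj : (V → V) → Set
  PreservesAdj f = ∀ u v → adjV (f u) (f v) ≡ adjV u v

  fixing-via-V : (P : Fin n → Set) →
                 (∀ (f : V → V) → Injective _≡_ _≡_ f → PreservesAdj f →
                    (∀ v → P (encode v) → f v ≡ v) → ∀ v → f v ≡ v) →
                 FixingPred graph P
  fixing-via-V P rigid σ σ-aut σ-fixes i = begin
      σ ⟨$⟩ʳ i                           ≡⟨ cong (σ ⟨$⟩ʳ_) (encode-decode i) ⟨
      σ ⟨$⟩ʳ encode (decode i)           ≡⟨ encode-decode _ ⟨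
      encode (f (decode i))             ≡⟨ cong encode (rigid f f-injective f-adj f-fixes (decode i)) ⟩
      encode (decode i)                 ≡⟨ encode-decode i ⟩
      i                                 ∎
    where
    open ≡-Reasoning
    f : V → V
    f v = decode (σ ⟨$⟩ʳ encode v)
    f-injective : Injective _≡_ _≡_ f
    f-injective = encode-injective ∘ permutation-injective σ ∘ Injection.injective (↔⇒↣ code)
    f-adj : PreservesAdj f
    f-adj u v = trans (σ-aut (encode u) (encode v)) (cong₂ adjV (decode-encode u) (decode-encode v))
    f-fixes : ∀ v → P (encode v) → f v ≡ v
    f-fixes v Pv = trans (cong decode (σ-fixes (encode v) Pv)) (decode-encode v)

  fixed-symmetry : (P : Fin n → Set) → FixingPred graph P →
                   (s : V ↔ V) → PreservesAdj (Inverse.to s) →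
                   (∀ v → P (encode v) → Inverse.to s v ≡ v) → ∀ v → Inverse.to s v ≡ v
  fixed-symmetry P P-fixing s s-adj s-fixes v =
    encode-injective (trans (cong (encode ∘ Inverse.to s) (sym (decode-encode v)))
                            (P-fixing σ σ-aut σ-fixes (encode v)))
    where
    open Inverse s using (to; from; strictlyInverseˡ; strictlyInverseʳ)
    σ : Permutation′ n
    σ = permutation (encode ∘ to ∘ decode) (encode ∘ from ∘ decode)
          (λ i → trans (cong (encode ∘ to) (decode-encode _)) (trans (cong encode (strictlyInverseˡ _)) (encode-decode i)))
          (λ i → trans (cong (encode ∘ from) (decode-encode _)) (trans (cong encode (strictlyInverseʳ _)) (encode-decode i)))
    σ-aut : IsAutomorphism graph σ
    σ-aut i j = trans (cong₂ adjV (decode-encode _) (decode-encode _)) (s-adj (decode i) (decode j))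
    σ-fixes : ∀ i → P i → σ ⟨$⟩ʳ i ≡ i
    σ-fixes i Pi = trans (cong encode (s-fixes (decode i) (subst P (sym (encode-decode i)) Pi))) (encode-decode i)

module Construction (K : ℕ) where

  L : ℕ
  L = suc K

  t : ℕ
  t = suc L

  open CyclicShift L

  -- Vertices: a hub adjacent to everything, an apex adjacent to the
  -- x-vertices, markers mark q for the positions q < L, and two families of
  -- L-cliques: x b p (clique b < t) and y a p (clique a < 2), where the
  -- vertex at position p of any clique is adjacent to mark p.
  V : Set
  V = ⊤ ⊎ ⊤ ⊎ Fin L ⊎ (Fin t × Fin L) ⊎ (Fin 2 × Fin L)

  pattern hub = inj₁ tt
  pattern apex = inj₂ (inj₁ tt)
  pattern mark q = inj₂ (inj₂ (inj₁ q))
  pattern x b p = inj₂ (inj₂ (inj₂ (inj₁ (b , p))))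
  pattern y a p = inj₂ (inj₂ (inj₂ (inj₂ (a , p))))

  n : ℕ
  n = 1 + (1 + (L + (t * L + 2 * L)))

  code : Fin n ↔ V
  code = ↔-trans +↔⊎ (1↔⊤ ⊎-↔ ↔-trans +↔⊎ (1↔⊤ ⊎-↔ ↔-trans +↔⊎ (↔-refl ⊎-↔ ↔-trans +↔⊎ (*↔× ⊎-↔ *↔×))))

  adjV : V → V → Bool
  adjV hub hub = false
  adjV hub _ = true
  adjV _ hub = true
  adjV apex (x _ _) = true
  adjV (x _ _) apex = true
  adjV (mark q) (x _ p) = p == q
  adjV (mark q) (y _ p) = p == q
  adjV (x _ p) (mark q) = p == q
  adjV (y _ p) (mark q) = p == q
  adjV (x b p) (x c q) = (b == c) ∧ not (p == q)
  adjV (y a p) (y c q) = (a == c) ∧ not (p == q)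
  adjV _ _ = false

  adjV-sym : ∀ u v → adjV u v ≡ adjV v u
  adjV-sym hub hub = refl
  adjV-sym hub apex = refl
  adjV-sym hub (mark _) = refl
  adjV-sym hub (x _ _) = refl
  adjV-sym hub (y _ _) = refl
  adjV-sym apex hub = refl
  adjV-sym apex apex = refl
  adjV-sym apex (mark _) = refl
  adjV-sym apex (x _ _) = refl
  adjV-sym apex (y _ _) = refl
  adjV-sym (mark _) hub = refl
  adjV-sym (mark _) apex = refl
  adjV-sym (mark _) (mark _) = refl
  adjV-sym (mark _) (x _ _) = refl
  adjV-sym (mark _) (y _ _) = refl
  adjV-sym (x _ _) hub = refl
  adjV-sym (x _ _) apex = refl
  adjV-sym (x _ _) (mark _) = refl
  adjV-sym (x b p) (x c q) = cong₂ (λ u v → u ∧ not v) (==-sym b c) (==-sym p q)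
  adjV-sym (x _ _) (y _ _) = refl
  adjV-sym (y _ _) hub = refl
  adjV-sym (y _ _) apex = refl
  adjV-sym (y _ _) (mark _) = refl
  adjV-sym (y _ _) (x _ _) = refl
  adjV-sym (y a p) (y c q) = cong₂ (λ u v → u ∧ not v) (==-sym a c) (==-sym p q)

  adjV-irrefl : ∀ v → adjV v v ≡ false
  adjV-irrefl hub = refl
  adjV-irrefl apex = refl
  adjV-irrefl (mark _) = refl
  adjV-irrefl (x b p) rewrite ==-refl p = ∧-zeroʳ (b == b)
  adjV-irrefl (y a p) rewrite ==-refl p = ∧-zeroʳ (a == a)

  open EnumeratedGraph code adjV adjV-sym adjV-irrefl public

  hub-universal : ∀ v → v ≢ hub → adjV hub v ≡ true
  hub-universal hub v≢hub = ⊥-elim (v≢hub refl)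
  hub-universal apex _ = refl
  hub-universal (mark _) _ = refl
  hub-universal (x _ _) _ = refl
  hub-universal (y _ _) _ = refl

  connected : Connected graph
  connected = universal⇒connected graph (encode hub) encoded-hub-universal
    where
    encoded-hub-universal : ∀ i → i ≢ encode hub → adjV (decode (encode hub)) (decode i) ≡ true
    encoded-hub-universal i i≢hub rewrite decode-encode hub =
      hub-universal (decode i) (λ eq → i≢hub (trans (sym (encode-decode i)) (cong encode eq)))

  relabel : (Fin t → Fin t) → (Fin 2 → Fin 2) → V → V
  relabel π ρ (x b p) = x (π b) p
  relabel π ρ (y a p) = y (ρ a) p
  relabel π ρ v = v

  relabel-inverse : ∀ {π π′ ρ ρ′} → (∀ b → π (π′ b) ≡ b) → (∀ a → ρ (ρ′ a) ≡ a) →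
                    ∀ v → relabel π ρ (relabel π′ ρ′ v) ≡ v
  relabel-inverse ππ′ ρρ′ hub = refl
  relabel-inverse ππ′ ρρ′ apex = refl
  relabel-inverse ππ′ ρρ′ (mark _) = refl
  relabel-inverse ππ′ ρρ′ (x b p) = cong (λ c → x c p) (ππ′ b)
  relabel-inverse ππ′ ρρ′ (y a p) = cong (λ c → y c p) (ρρ′ a)

  relabel↔ : Permutation′ t → Permutation′ 2 → V ↔ V
  relabel↔ π ρ = mk↔ₛ′ (relabel (π ⟨$⟩ʳ_) (ρ ⟨$⟩ʳ_)) (relabel (π ⟨$⟩ˡ_) (ρ ⟨$⟩ˡ_))
                       (relabel-inverse (λ _ → inverseʳ π) (λ _ → inverseʳ ρ))
                       (relabel-inverse (λ _ → inverseˡ π) (λ _ → inverseˡ ρ))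

  relabel-adj : ∀ {π ρ} → Injective _≡_ _≡_ π → Injective _≡_ _≡_ ρ → PreservesAdj (relabel π ρ)
  relabel-adj π-inj ρ-inj hub hub = refl
  relabel-adj π-inj ρ-inj hub apex = refl
  relabel-adj π-inj ρ-inj hub (mark _) = refl
  relabel-adj π-inj ρ-inj hub (x _ _) = refl
  relabel-adj π-inj ρ-inj hub (y _ _) = refl
  relabel-adj π-inj ρ-inj apex hub = refl
  relabel-adj π-inj ρ-inj apex apex = refl
  relabel-adj π-inj ρ-inj apex (mark _) = refl
  relabel-adj π-inj ρ-inj apex (x _ _) = refl
  relabel-adj π-inj ρ-inj apex (y _ _) = refl
  relabel-adj π-inj ρ-inj (mark _) hub = refl
  relabel-adj π-inj ρ-inj (mark _) apex = refl
  relabel-adj π-inj ρ-inj (mark _) (mark _) = refl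
  relabel-adj π-inj ρ-inj (mark _) (x _ _) = refl
  relabel-adj π-inj ρ-inj (mark _) (y _ _) = refl
  relabel-adj π-inj ρ-inj (x _ _) hub = refl
  relabel-adj π-inj ρ-inj (x _ _) apex = refl
  relabel-adj π-inj ρ-inj (x _ _) (mark _) = refl
  relabel-adj π-inj ρ-inj (x b p) (x c q) = cong (λ u → u ∧ not (p == q)) (==-injective π-inj b c)
  relabel-adj π-inj ρ-inj (x _ _) (y _ _) = refl
  relabel-adj π-inj ρ-inj (y _ _) hub = refl
  relabel-adj π-inj ρ-inj (y _ _) apex = refl
  relabel-adj π-inj ρ-inj (y _ _) (mark _) = refl
  relabel-adj π-inj ρ-inj (y _ _) (x _ _) = refl
  relabel-adj π-inj ρ-inj (y a p) (y c q) = cong (λ u → u ∧ not (p == q)) (==-injective ρ-inj a c)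

  x-clique : ∀ {c c′ : Fin t} {p p′ : Fin L} → x c′ p′ ≡ (V ∋ x c p) → c′ ≡ c
  x-clique refl = refl

  y-clique : ∀ {a a′ : Fin 2} {p p′ : Fin L} → y a′ p′ ≡ (V ∋ y a p) → a′ ≡ a
  y-clique refl = refl

  mark≢apex : ∀ {q : Fin L} → mark q ≢ (V ∋ apex)
  mark≢apex ()

  y≢apex : ∀ {a : Fin 2} {p : Fin L} → y a p ≢ (V ∋ apex)
  y≢apex ()

  x-same-position : ∀ b c p → adjV (x b p) (x c p) ≡ false
  x-same-position b c p rewrite ==-refl p = ∧-zeroʳ (b == c)

  -- A seed configuration: an anchor y a₀ j₀ and, at every position q, the
  -- seed x (β q) q.  Adjacency to these vertices pins down every vertex.
  module Seeds (β : Fin L → Fin t) (a₀ : Fin 2) (j₀ : Fin L) where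

    anchor : V
    anchor = y a₀ j₀

    seed-at : Fin L → V
    seed-at q = x (β q) q

    apex-unique : ∀ w → adjV w anchor ≡ false → (∀ q → adjV w (seed-at q) ≡ true) → w ≡ apex
    apex-unique hub () _
    apex-unique apex _ _ = refl
    apex-unique (mark _) w≁anchor w~seed = ⊥-elim (false≢true (trans (sym w≁anchor) (w~seed j₀)))
    apex-unique (x b p) _ w~seed = ⊥-elim (false≢true (trans (sym (x-same-position b (β p) p)) (w~seed p)))
    apex-unique (y _ _) _ w~seed = ⊥-elim (false≢true (w~seed j₀))

    mark-unique : ∀ q w → adjV w (seed-at q) ≡ true → adjV w apex ≡ false → w ≢ apex → w ≡ mark q
    mark-unique q hub _ ()
    mark-unique q apex _ _ w≢apex = ⊥-elim (w≢apex refl)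
    mark-unique q (mark r) q≡r _ _ = cong mark (sym (==-sound q≡r))
    mark-unique q (x _ _) _ ()
    mark-unique q (y _ _) () _

    x-shape : ∀ p w → adjV w apex ≡ true → adjV w (mark p) ≡ true → adjV w anchor ≡ false → ∃ λ b → w ≡ x b p
    x-shape p hub _ _ ()
    x-shape p apex () _ _
    x-shape p (mark _) () _ _
    x-shape p (x b q) _ q≡p _ = b , cong (x b) (==-sound q≡p)
    x-shape p (y _ _) () _ _

    y-shape : ∀ p w → adjV w apex ≡ false → adjV w (mark p) ≡ true → w ≢ apex → ∃ λ a → w ≡ y a p
    y-shape p hub () _ _
    y-shape p apex _ _ w≢apex = ⊥-elim (w≢apex refl)
    y-shape p (mark _) _ () _
    y-shape p (x _ _) () _ _
    y-shape p (y a q) _ q≡p _ = a , cong (y a) (==-sound q≡p)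

    x-test : ∀ c p q → q ≢ p → adjV (x c p) (seed-at q) ≡ (c == β q)
    x-test c p q q≢p rewrite ==-false (q≢p ∘ sym) = ∧-identityʳ (c == β q)

    y-test : ∀ c p → p ≢ j₀ → adjV (y c p) anchor ≡ (c == a₀)
    y-test c p p≢j₀ rewrite ==-false p≢j₀ = ∧-identityʳ (c == a₀)

    module Rigidity (r : Fin t) (cover : ∀ b → b ≡ r ⊎ ∃ λ q → β q ≡ b)
                    (f : V → V) (f-inj : Injective _≡_ _≡_ f) (f-adj : PreservesAdj f)
                    (fixes-seed : ∀ q → f (seed-at q) ≡ seed-at q) (fixes-anchor : f anchor ≡ anchor) where

      adj-to-fixed : ∀ {w} → f w ≡ w → ∀ v → adjV (f v) w ≡ adjV v w
      adj-to-fixed {w} fw v = trans (cong (adjV (f v)) (sym fw)) (f-adj v w)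

      fixed-preimage : ∀ {u v} → f u ≡ u → f v ≡ u → v ≡ u
      fixed-preimage fu fv = f-inj (trans fv (sym fu))

      f-apex : f apex ≡ apex
      f-apex = apex-unique (f apex) (adj-to-fixed fixes-anchor apex) (λ q → adj-to-fixed (fixes-seed q) apex)

      f-mark : ∀ q → f (mark q) ≡ mark q
      f-mark q = mark-unique q (f (mark q)) (trans (adj-to-fixed (fixes-seed q) (mark q)) (==-refl q))
                   (adj-to-fixed f-apex (mark q)) (λ moved → mark≢apex (fixed-preimage f-apex moved))

      CliqueKind : Fin L → Fin t → Set
      CliqueKind p c = (∃ λ q → q ≢ p × β q ≡ c) ⊎ c ≡ β p ⊎ c ≡ r

      clique-kind : ∀ p c → CliqueKind p c
      clique-kind p c with cover c
      ... | inj₁ c≡r = inj₂ (inj₂ c≡r)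
      ... | inj₂ (q , βq≡c) with q ≟ p
      ...   | yes refl = inj₂ (inj₁ (sym βq≡c))
      ...   | no q≢p = inj₁ (q , q≢p , βq≡c)

      x-index : ∀ b b′ p → f (x b p) ≡ x b′ p → b′ ≡ b
      x-index b b′ p moved = by-kinds (clique-kind p b) (clique-kind p b′)
        where
        same-test : ∀ q → q ≢ p → (b′ == β q) ≡ (b == β q)
        same-test q q≢p = begin
          b′ == β q                     ≡⟨ x-test b′ p q q≢p ⟨
          adjV (x b′ p) (seed-at q)     ≡⟨ cong (λ w → adjV w (seed-at q)) moved ⟨
          adjV (f (x b p)) (seed-at q)  ≡⟨ adj-to-fixed (fixes-seed q) (x b p) ⟩
          adjV (x b p) (seed-at q)      ≡⟨ x-test b p q q≢p ⟩
          b == β q                      ∎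
          where open ≡-Reasoning
        by-kinds : CliqueKind p b → CliqueKind p b′ → b′ ≡ b
        by-kinds (inj₁ (q , q≢p , βq≡b)) _ = ==-transfer (same-test q q≢p) βq≡b
        by-kinds _ (inj₁ (q , q≢p , βq≡b′)) = sym (==-transfer (sym (same-test q q≢p)) βq≡b′)
        by-kinds (inj₂ (inj₁ b≡βp)) _ =
          x-clique (trans (sym moved) (subst (λ c → f (x c p) ≡ x c p) (sym b≡βp) (fixes-seed p)))
        by-kinds _ (inj₂ (inj₁ b′≡βp)) =
          trans b′≡βp (sym (x-clique (fixed-preimage (fixes-seed p) (trans moved (cong (λ c → x c p) b′≡βp)))))
        by-kinds (inj₂ (inj₂ b≡r)) (inj₂ (inj₂ b′≡r)) = trans b′≡r (sym b≡r)

      f-x : ∀ b p → f (x b p) ≡ x b p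
      f-x b p with x-shape p (f (x b p)) (adj-to-fixed f-apex (x b p))
                     (trans (adj-to-fixed (f-mark p) (x b p)) (==-refl p)) (adj-to-fixed fixes-anchor (x b p))
      ... | b′ , moved = trans moved (cong (λ c → x c p) (x-index b b′ p moved))

      y-index : ∀ a a′ p → f (y a p) ≡ y a′ p → a′ ≡ a
      y-index a a′ p moved with p ≟ j₀
      ... | no p≢j₀ = fin2-by-test (begin
            a′ == a₀                  ≡⟨ y-test a′ p p≢j₀ ⟨
            adjV (y a′ p) anchor      ≡⟨ cong (λ w → adjV w anchor) moved ⟨
            adjV (f (y a p)) anchor   ≡⟨ adj-to-fixed fixes-anchor (y a p) ⟩
            adjV (y a p) anchor       ≡⟨ y-test a p p≢j₀ ⟩
            a == a₀                   ∎)
        where open ≡-Reasoning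
      ... | yes refl with a ≟ a₀ | a′ ≟ a₀
      ...   | yes refl | _ = y-clique (trans (sym moved) fixes-anchor)
      ...   | _ | yes refl = sym (y-clique (fixed-preimage fixes-anchor moved))
      ...   | no a≢a₀ | no a′≢a₀ = fin2-other a≢a₀ a′≢a₀

      f-y : ∀ a p → f (y a p) ≡ y a p
      f-y a p with y-shape p (f (y a p)) (adj-to-fixed f-apex (y a p))
                     (trans (adj-to-fixed (f-mark p) (y a p)) (==-refl p))
                     (λ moved → y≢apex (fixed-preimage f-apex moved))
      ... | a′ , moved = trans moved (cong (λ c → y c p) (y-index a a′ p moved))

      -- every vertex but the hub is now known to be fixed, so the hub is too
      f-hub : f hub ≡ hub
      f-hub = hub-image (f hub) refl
        where
        hub-image : ∀ w → f hub ≡ w → f hub ≡ hub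
        hub-image hub moved = moved
        hub-image apex moved = trans moved (sym (fixed-preimage f-apex moved))
        hub-image (mark q) moved = trans moved (sym (fixed-preimage (f-mark q) moved))
        hub-image (x b p) moved = trans moved (sym (fixed-preimage (f-x b p) moved))
        hub-image (y a p) moved = trans moved (sym (fixed-preimage (f-y a p) moved))

      rigid : ∀ v → f v ≡ v
      rigid hub = f-hub
      rigid apex = f-apex
      rigid (mark q) = f-mark q
      rigid (x b p) = f-x b p
      rigid (y a p) = f-y a p

  seeds-fixing : (P : Fin n → Set) (β : Fin L → Fin t) (r : Fin t) → (∀ b → b ≡ r ⊎ ∃ λ q → β q ≡ b) →
                 (a₀ : Fin 2) (j₀ : Fin L) → (∀ q → P (encode (x (β q) q))) → P (encode (y a₀ j₀)) →
                 FixingPred graph P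
  seeds-fixing P β r cover a₀ j₀ P-seeds P-anchor = fixing-via-V P rigid
    where
    open Seeds β a₀ j₀
    rigid : ∀ f → Injective _≡_ _≡_ f → PreservesAdj f → (∀ v → P (encode v) → f v ≡ v) → ∀ v → f v ≡ v
    rigid f f-inj f-adj f-fixes = Rigidity.rigid r cover f f-inj f-adj (λ q → f-fixes _ (P-seeds q)) (f-fixes _ P-anchor)

  -- What every fixing set must contain: a y-vertex, and a vertex in every
  -- x-clique except at most one.  Otherwise a transposition of two unhit
  -- cliques is a nontrivial symmetry fixing the set.
  module Hitting (P : Fin n → Set) (P? : Decidable P) (P-fixing : FixingPred graph P) where

    Hits : Fin t → Set
    Hits b = ∃ λ p → P (encode (x b p))

    hits? : ∀ b → Dec (Hits b)
    hits? b = any? (λ p → P? (encode (x b p)))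

    y-hit : ∃ λ a → ∃ λ p → P (encode (y a p))
    y-hit = decidable-stable (any? (λ a → any? (λ p → P? (encode (y a p))))) y-missed
      where
      y-missed : ¬ (∃ λ a → ∃ λ p → P (encode (y a p))) → ⊥
      y-missed miss = y1≢y0 (fixed-symmetry P P-fixing flip
                                (relabel-adj (permutation-injective Perm.id) (permutation-injective swap))
                                flip-fixes (y 0F 0F))
        where
        swap : Permutation′ 2
        swap = transpose 0F 1F
        flip : V ↔ V
        flip = relabel↔ Perm.id swap
        flip-fixes : ∀ v → P (encode v) → Inverse.to flip v ≡ v
        flip-fixes hub _ = refl
        flip-fixes apex _ = refl
        flip-fixes (mark _) _ = refl
        flip-fixes (x _ _) _ = refl
        flip-fixes (y a p) Pv = ⊥-elim (miss (a , p , Pv))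
        y1≢y0 : y 1F 0F ≢ (V ∋ y 0F 0F)
        y1≢y0 ()

    unhit-unique : ∀ b m → b ≢ m → ¬ Hits b → ¬ Hits m → ⊥
    unhit-unique b m b≢m b-miss m-miss =
      b≢m (sym (trans (sym (transpose-source b m))
                      (x-clique (fixed-symmetry P P-fixing swap
                                   (relabel-adj (permutation-injective (transpose b m)) (permutation-injective Perm.id))
                                   swap-fixes (x b 0F)))))
      where
      swap : V ↔ V
      swap = relabel↔ (transpose b m) Perm.id
      swap-fixes : ∀ v → P (encode v) → Inverse.to swap v ≡ v
      swap-fixes hub _ = refl
      swap-fixes apex _ = refl
      swap-fixes (mark _) _ = refl
      swap-fixes (y _ _) _ = refl
      swap-fixes (x c p) Pv = cong (λ d → x d p) (transpose-other (λ { refl → b-miss (p , Pv) })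
                                                                   (λ { refl → m-miss (p , Pv) }))

    x-hits : ∃ λ m → ∀ b → b ≢ m → Hits b
    x-hits with any? (λ m → ¬? (hits? m))
    ... | yes (m , m-miss) = m , λ b b≢m → decidable-stable (hits? b) (λ b-miss → unhit-unique b m b≢m b-miss m-miss)
    ... | no all-hit = 0F , λ b _ → decidable-stable (hits? b) (λ b-miss → all-hit (b , b-miss))

    missed : Fin t
    missed = proj₁ x-hits

    hit-clique : Fin L → Fin t
    hit-clique j = punchIn missed j

    hit-position : Fin L → Fin L
    hit-position j = proj₁ (proj₂ x-hits (hit-clique j) (punchInᵢ≢i missed j))

    hit-∈ : ∀ j → P (encode (x (hit-clique j) (hit-position j)))
    hit-∈ j = proj₂ (proj₂ x-hits (hit-clique j) (punchInᵢ≢i missed j))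

  -- Lower bound for fix(G): a fixing set contains a y-vertex and t − 1
  -- x-vertices from distinct cliques.
  fixing-set-size : ∀ F → IsFixingSet graph F → t ≤ ∣ F ∣
  fixing-set-size F F-fixing = injection⇒≤∣F∣ chosen chosen-injective F chosen-∈
    where
    open Hitting (_∈ F) (_∈? F) F-fixing
    chosen-vertex : Fin t → V
    chosen-vertex 0F = y (proj₁ y-hit) (proj₁ (proj₂ y-hit))
    chosen-vertex (Fin.suc j) = x (hit-clique j) (hit-position j)
    chosen : Fin t → Fin n
    chosen = encode ∘ chosen-vertex
    chosen-∈ : ∀ j → chosen j ∈ F
    chosen-∈ 0F = proj₂ (proj₂ y-hit)
    chosen-∈ (Fin.suc j) = hit-∈ j
    chosen-vertex-injective : Injective _≡_ _≡_ chosen-vertex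
    chosen-vertex-injective {0F} {0F} _ = refl
    chosen-vertex-injective {Fin.suc i} {Fin.suc j} eq = cong Fin.suc (punchIn-injective missed i j (sym (x-clique (sym eq))))
    chosen-injective : Injective _≡_ _≡_ chosen
    chosen-injective {i} {j} eq = chosen-vertex-injective (encode-injective {chosen-vertex i} {chosen-vertex j} eq)

  -- Upper bound for F_xt(G): each of the k classes contains vertices in t − 1
  -- distinct x-cliques at distinct positions, and there are only t · L
  -- x-vertices, so k · L ≤ t · L.
  fixatic-size : ∀ k (c : Fin n → Fin k) → IsFixaticPartition graph k c → k ≤ t
  fixatic-size k c (_ , classes-fixing) = *-cancelʳ-≤ k t L (product-injection⇒≤ pick pick-injective)
    where
    module Class (i : Fin k) = Hitting (λ v → c v ≡ i) (λ v → c v ≟ i) (classes-fixing i)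
    pick : Fin k × Fin L → Fin t × Fin L
    pick (i , j) = Class.hit-clique i j , Class.hit-position i j
    pick-injective : Injective _≡_ _≡_ pick
    pick-injective {i , j} {i′ , j′} eq with trans (sym (Class.hit-∈ i j))
                                              (trans (cong (λ (b , p) → c (encode (x b p))) eq) (Class.hit-∈ i′ j′))
    ... | refl = cong (i ,_) (punchIn-injective (Class.missed i) j j′ (cong proj₁ eq))

  -- The partition: the vertex at position q of clique b goes to class
  -- colour b q; class 0 also receives y-clique 1, class 1 + p receives
  -- y 0 p, and hub, apex and markers go to class 0.  Class i then contains
  -- the seeds x (seed i q) q and an anchor y-vertex.
  classOf : V → Fin t
  classOf (x b p) = colour b p
  classOf (y 0F p) = Fin.suc p
  classOf _ = 0F

  class-anchor : Fin t → Fin 2 × Fin L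
  class-anchor 0F = 1F , 0F
  class-anchor (Fin.suc p) = 0F , p

  anchor-class : ∀ i → classOf (uncurry y (class-anchor i)) ≡ i
  anchor-class 0F = refl
  anchor-class (Fin.suc p) = refl

  seed-class-cover : ∀ i b → b ≡ i ⊎ ∃ λ q → seed i q ≡ b
  seed-class-cover i b with b ≟ i
  ... | yes b≡i = inj₁ b≡i
  ... | no b≢i = inj₂ (seed-cover i b b≢i)

  class-fixing : ∀ (P : Fin n → Set) i → (∀ v → classOf v ≡ i → P (encode v)) → FixingPred graph P
  class-fixing P i in-P = seeds-fixing P (seed i) i (seed-class-cover i)
                            (proj₁ (class-anchor i)) (proj₂ (class-anchor i))
                            (λ q → in-P (x (seed i q) q) (colour-seed i q)) (in-P (uncurry y (class-anchor i)) (anchor-class i))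

  partition : Fin n → Fin t
  partition v = classOf (decode v)

  in-class : ∀ i v → classOf v ≡ i → partition (encode v) ≡ i
  in-class i v eq = trans (cong classOf (decode-encode v)) eq

  fixatic-partition : IsFixaticPartition graph t partition
  fixatic-partition = nonempty , λ i → class-fixing (λ v → partition v ≡ i) i (in-class i)
    where
    nonempty : ∀ i → ∃ λ v → partition v ≡ i
    nonempty i = encode seed₀ , in-class i seed₀ (colour-seed i 0F)
      where
      seed₀ : V
      seed₀ = x (seed i 0F) 0F

  class₀-seeds : Fin t → Fin n
  class₀-seeds 0F = encode (y 1F 0F)
  class₀-seeds (Fin.suc q) = encode (x (seed 0F q) q)

  fix-number : FixNumberIs graph t
  fix-number = (image class₀-seeds , fixing , ≤-antisym (∣image∣≤ class₀-seeds) (fixing-set-size _ fixing))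
             , fixing-set-size
    where
    fixing : IsFixingSet graph (image class₀-seeds)
    fixing = seeds-fixing (_∈ image class₀-seeds) (seed 0F) 0F (seed-class-cover 0F) 1F 0F
               (λ q → ∈-image class₀-seeds (Fin.suc q)) (∈-image class₀-seeds 0F)

  fixatic-number : FixaticNumberIs graph t
  fixatic-number = (partition , fixatic-partition) , fixatic-size

mainTheorem15 : ∀ (t : ℕ) → t ≥ 2 →
    Σ Graph λ G → Connected G × FixNumberIs G t × FixaticNumberIs G t
mainTheorem15 (suc (suc K)) (s≤s (s≤s z≤n)) = graph , connected , fix-number , fixatic-number
  where open Construction K
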